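{- The theory $\mathsf{PA}^-_{\mathsf{jer}}$ plus the Predecessor Principle $x=0\vee\exists y\,x=y+1$ plus the Euclidean Division Principle $y\neq0\to\exists z\,\exists r\,(r<y\wedge x=z\cdot y+r)$ proves the Subtraction Principle $y\leq x\to\exists z\,x=y+z$.
   Context: $\mathsf{PA}^-_{\mathsf{jer}}$ is the theory in the language $0,1,+,\times,\leq$ with axioms: $x+0=x$; $x+y=y+x$; $(x+y)+z=x+(y+z)$; $x\cdot1=x$; $x\cdot y=y\cdot x$; $(x\cdot y)\cdot z=x\cdot(y\cdot z)$; $x\cdot(y+z)=x\cdot y+x\cdot z$; $x\leq y\vee y\leq x$; $(x\leq y\wedge y\leq z)\to x\leq z$; $x+1\not\leq x$; $y\leq x\to(y=x\vee y+1\leq x)$; $y\leq x\to y+z\leq x+z$; $y\leq x\to y\cdot z\leq x\cdot z$. Here $x<y$ means $x\leq y\wedge x\neq y$. -}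

module Defs where

open import Data.Empty using (⊥)
open import Data.Product using (Σ; _×_)
open import Data.Sum using (_⊎_)
open import Relation.Nullary using (¬_)
open import Relation.Binary.PropositionalEquality using (_≡_; _≢_)

-- A model (structure) for the language 0,1,+,×,≤ — equality interpreted as
-- actual (propositional) equality — satisfying the axioms of PA⁻_jer.
record PAjerModel : Set₁ where
  infixl 6 _+_
  infixl 7 _·_
  infix 4 _≤_ _<_
  field
    M   : Set
    0#  : M
    1#  : M
    _+_ : M → M → M
    _·_ : M → M → M
    _≤_ : M → M → Set
    +-identityʳ : ∀ x → x + 0# ≡ x
    +-comm      : ∀ x y → x + y ≡ y + x
    +-assoc     : ∀ x y z → (x + y) + z ≡ x + (y + z)
    ·-identityʳ : ∀ x → x · 1# ≡ x
    ·-comm      : ∀ x y → x · y ≡ y · x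
    ·-assoc     : ∀ x y z → (x · y) · z ≡ x · (y · z)
    distrib     : ∀ x y z → x · (y + z) ≡ x · y + x · z
    ≤-total     : ∀ x y → x ≤ y ⊎ y ≤ x
    ≤-trans     : ∀ x y z → x ≤ y → y ≤ z → x ≤ z
    suc-≰       : ∀ x → ¬ (x + 1# ≤ x)
    ≤-discrete  : ∀ x y → y ≤ x → (y ≡ x) ⊎ (y + 1# ≤ x)
    +-mono-≤    : ∀ x y z → y ≤ x → y + z ≤ x + z
    ·-mono-≤    : ∀ x y z → y ≤ x → y · z ≤ x · z

  _<_ : M → M → Set
  x < y = (x ≤ y) × (x ≢ y)

  PredecessorPrinciple : Set
  PredecessorPrinciple = ∀ x → (x ≡ 0#) ⊎ Σ M (λ y → x ≡ y + 1#)

  EuclideanDivisionPrinciple : Set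
  EuclideanDivisionPrinciple =
    ∀ x y → y ≢ 0# → Σ M (λ z → Σ M (λ r → (r < y) × (x ≡ z · y + r)))

  SubtractionPrinciple : Set
  SubtractionPrinciple = ∀ x y → y ≤ x → Σ M (λ z → x ≡ y + z)

{-# OPTIONS --safe #-}
module Submission where

-- Divide x by y ≠ 0: x = q·y + r with r < y. The quotient q cannot be 0,
-- since then x = r < y ≤ x; so q = q' + 1 and x = y + (q'·y + r).

open import Defs
open import Data.Empty using (⊥-elim)
open import Data.Product using (_,_)
open import Data.Sum using (inj₁; inj₂)
open import Relation.Nullary using (¬_)
open import Relation.Binary.PropositionalEquality

module PAjerProperties (𝔐 : PAjerModel) where
  open PAjerModel 𝔐
  open ≡-Reasoning

  +-identityˡ : ∀ x → 0# + x ≡ x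
  +-identityˡ x = trans (+-comm 0# x) (+-identityʳ x)

  ·-identityˡ : ∀ x → 1# · x ≡ x
  ·-identityˡ x = trans (·-comm 1# x) (·-identityʳ x)

  +-suc-comm : ∀ x y → (x + 1#) + y ≡ (x + y) + 1#
  +-suc-comm x y = begin
    (x + 1#) + y  ≡⟨ +-assoc x 1# y ⟩
    x + (1# + y)  ≡⟨ cong (x +_) (+-comm 1# y) ⟩
    x + (y + 1#)  ≡⟨ +-assoc x y 1# ⟨
    (x + y) + 1#  ∎

  ≤-antisym : ∀ x y → x ≤ y → y ≤ x → x ≡ y
  ≤-antisym x y x≤y y≤x with ≤-discrete y x x≤y
  ... | inj₁ x≡y   = x≡y
  ... | inj₂ x+1≤y = ⊥-elim (suc-≰ x (≤-trans (x + 1#) y x x+1≤y y≤x))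

  <⇒≱ : ∀ {x y} → x < y → ¬ y ≤ x
  <⇒≱ {x} {y} (x≤y , x≢y) y≤x = x≢y (≤-antisym x y x≤y y≤x)

  +-cancelʳ-≤ : ∀ x y z → x ≤ y → x + z ≡ y + z → x ≡ y
  +-cancelʳ-≤ x y z x≤y eq with ≤-discrete y x x≤y
  ... | inj₁ x≡y   = x≡y
  ... | inj₂ x+1≤y = ⊥-elim (suc-≰ (x + z) x+z+1≤x+z)
    where
    x+z+1≤x+z : (x + z) + 1# ≤ x + z
    x+z+1≤x+z = subst₂ _≤_ (+-suc-comm x z) (sym eq) (+-mono-≤ y (x + 1#) z x+1≤y)

  +-cancelʳ-≡ : ∀ x y z → x + z ≡ y + z → x ≡ y
  +-cancelʳ-≡ x y z eq with ≤-total x y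
  ... | inj₁ x≤y = +-cancelʳ-≤ x y z x≤y eq
  ... | inj₂ y≤x = sym (+-cancelʳ-≤ y x z y≤x (sym eq))

  ·-zeroʳ : ∀ x → x · 0# ≡ 0#
  ·-zeroʳ x = +-cancelʳ-≡ (x · 0#) 0# (x · 0#) (begin
    x · 0# + x · 0#  ≡⟨ distrib x 0# 0# ⟨
    x · (0# + 0#)    ≡⟨ cong (x ·_) (+-identityʳ 0#) ⟩
    x · 0#           ≡⟨ +-identityˡ (x · 0#) ⟨
    0# + x · 0#      ∎)

  ·-zeroˡ : ∀ x → 0# · x ≡ 0#
  ·-zeroˡ x = trans (·-comm 0# x) (·-zeroʳ x)

  ·-sucˡ : ∀ x y → (x + 1#) · y ≡ y + x · y
  ·-sucˡ x y = begin
    (x + 1#) · y   ≡⟨ ·-comm (x + 1#) y ⟩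
    y · (x + 1#)   ≡⟨ distrib y x 1# ⟩
    y · x + y · 1# ≡⟨ cong₂ _+_ (·-comm y x) (·-identityʳ y) ⟩
    x · y + y      ≡⟨ +-comm (x · y) y ⟩
    y + x · y      ∎

  0≤1 : 0# ≤ 1#
  0≤1 with ≤-total 0# 1#
  ... | inj₁ 0≤1 = 0≤1
  ... | inj₂ 1≤0 = ⊥-elim (suc-≰ 0# (subst (_≤ 0#) (sym (+-identityˡ 1#)) 1≤0))

  0≤x : ∀ x → 0# ≤ x
  0≤x x = subst₂ _≤_ (·-zeroˡ x) (·-identityˡ x) (·-mono-≤ 1# 0# x 0≤1)

  suc≢0 : ∀ x → x + 1# ≢ 0#
  suc≢0 x x+1≡0 = suc-≰ 0# (subst (0# + 1# ≤_) x+1≡0 (+-mono-≤ x 0# 1# (0≤x x)))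

  subtraction : PredecessorPrinciple → EuclideanDivisionPrinciple → SubtractionPrinciple
  subtraction pred div x y y≤x with pred y
  ... | inj₁ y≡0 = x , sym (trans (cong (_+ x) y≡0) (+-identityˡ x))
  ... | inj₂ (y' , y≡y'+1) with div x y (λ y≡0 → suc≢0 y' (trans (sym y≡y'+1) y≡0))
  ...   | q , r , r<y , x≡qy+r with pred q
  ...     | inj₁ q≡0 = ⊥-elim (<⇒≱ r<y (subst (y ≤_) x≡r y≤x))
    where
    x≡r : x ≡ r
    x≡r = begin
      x           ≡⟨ x≡qy+r ⟩
      q · y + r   ≡⟨ cong (λ t → t · y + r) q≡0 ⟩
      0# · y + r  ≡⟨ cong (_+ r) (·-zeroˡ y) ⟩
      0# + r      ≡⟨ +-identityˡ r ⟩
      r           ∎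
  ...     | inj₂ (q' , q≡q'+1) = q' · y + r , (begin
      x                   ≡⟨ x≡qy+r ⟩
      q · y + r           ≡⟨ cong (λ t → t · y + r) q≡q'+1 ⟩
      (q' + 1#) · y + r   ≡⟨ cong (_+ r) (·-sucˡ q' y) ⟩
      (y + q' · y) + r    ≡⟨ +-assoc y (q' · y) r ⟩
      y + (q' · y + r)    ∎)

mainTheorem10 : (𝔐 : PAjerModel) →
    PAjerModel.PredecessorPrinciple 𝔐 →
    PAjerModel.EuclideanDivisionPrinciple 𝔐 →
    PAjerModel.SubtractionPrinciple 𝔐
mainTheorem10 𝔐 = PAjerProperties.subtraction 𝔐
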